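{- Let $n\ge1$ and $k\ge 1$ be integers, and in $\mathbb{Q}S_n$ let $$s=\sum_{w\in S_n}\frac{1}{k^n}\binom{n+k-d(w^{ -1})-1}{n}\,w,\qquad c=\frac1n\sum_{i=0}^{n-1}\zeta^i,\quad \zeta=(1\,2\,\cdots\,n).$$ Then $csc=cs$.
   Context: Permutations multiply by composition $(\sigma\tau)(x)=\sigma(\tau(x))$. For $w\in S_n$, $d(w)$ is the number of $1\le i\le n-1$ with $w(i)>w(i+1)$. The element $s$ represents a $k$-riffle shuffle (Gilbert–Shannon–Reeds) and $c$ a cut at a uniform position. -}

module Defs where

open import Data.Nat using (ℕ; zero; suc; _+_; _∸_; _^_; _<ᵇ_)
open import Data.Nat.Combinatorics using (_C_)
open import Data.Fin using (Fin; zero; suc; toℕ) renaming (_≟_ to _≟ᶠ_)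
open import Data.Fin.Properties using (all?)
open import Data.Vec using (Vec; []; _∷_; lookup; tabulate; allFin)
open import Data.Vec.Properties using () renaming (≡-dec to vec-dec)
open import Data.List using (List; []; _∷_; map; concatMap; filter; foldr)
open import Data.Product using (_×_; _,_)
open import Data.Bool using (if_then_else_)
open import Data.Integer using (ℤ; +_)
open import Data.Rational using (ℚ; 0ℚ; 1ℚ) renaming (_+_ to _+ℚ_; _*_ to _*ℚ_)
import Data.Rational as Q
open import Relation.Binary.PropositionalEquality using (_≡_; _≢_)
open import Relation.Nullary using (Dec; yes; no; ¬_; does)
open import Relation.Nullary.Decidable using (⌊_⌋)
open import Data.Fin.Properties using (any?)

-- A permutation of {1..n} (0-indexed as Fin n) in one-line notation:
-- w is the vector (w(0), …, w(n-1)).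
Word : ℕ → Set
Word n = Vec (Fin n) n

-- w is injective (equivalently bijective, Fin n being finite)
IsPerm : ∀ {n} → Word n → Set
IsPerm {n} w = (i j : Fin n) → lookup w i ≡ lookup w j → i ≡ j

isPerm? : ∀ {n} (w : Word n) → Dec (IsPerm w)
isPerm? {n} w = all? (λ i → all? (λ j → dec i j))
  where
  dec : (i j : Fin n) → Dec (lookup w i ≡ lookup w j → i ≡ j)
  dec i j with lookup w i ≟ᶠ lookup w j | i ≟ᶠ j
  ... | _      | yes p = yes (λ _ → p)
  ... | no q   | no _  = yes (λ e → Data.Empty.⊥-elim (q e))
    where import Data.Empty
  ... | yes q  | no r  = no (λ f → r (f q))

allVecs : ∀ n m → List (Vec (Fin n) m)
allVecs n zero = [] ∷ []
allVecs n (suc m) =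
  concatMap (λ x → map (x ∷_) (allVecs n m)) (Data.Vec.toList (allFin n))
  where import Data.Vec

Sym : ∀ n → List (Word n)
Sym n = filter isPerm? (allVecs n n)

_∘ₚ_ : ∀ {n} → Word n → Word n → Word n
σ ∘ₚ τ = tabulate (λ x → lookup σ (lookup τ x))

idₚ : ∀ {n} → Word n
idₚ = tabulate (λ x → x)

-- inverse: w⁻¹(y) = the x with w(x) = y (found by search; for a
-- permutation such an x always exists, the fallback is never used)
findPre : ∀ {n m} → Word n → Fin n → Vec (Fin n) m → Fin n → Fin n
findPre w y [] dflt = dflt
findPre w y (x ∷ xs) dflt with lookup w x ≟ᶠ y
... | yes _ = x
... | no  _ = findPre w y xs dflt

inv : ∀ {n} → Word n → Word n
inv {n} w = tabulate (λ y → findPre w y (allFin n) y)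

desVec : ∀ {n m} → Vec (Fin n) m → ℕ
desVec [] = 0
desVec (a ∷ []) = 0
desVec (a ∷ b ∷ xs) =
  (if toℕ b <ᵇ toℕ a then 1 else 0) + desVec (b ∷ xs)

des : ∀ {n} → Word n → ℕ
des = desVec

-- the cycle ζ = (1 2 ⋯ n): ζ(i) = i+1 (mod n), in 0-indexed form,
-- i.e. one-line notation (1, 2, …, n-1, 0)
ζ : ∀ n → Word n
ζ zero = []
ζ (suc m) = tabulate {n = m} (λ i → suc i) Data.Vec.∷ʳ zero
  where import Data.Vec

_^ₚ_ : ∀ {n} → Word n → ℕ → Word n
w ^ₚ zero = idₚ
w ^ₚ suc i = w ∘ₚ (w ^ₚ i)

-- The group algebra ℚS_n: an element is a finite formal sum
-- Σ q_j w_j, represented as a list of (coefficient, permutation) pairs.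

QS : ℕ → Set
QS n = List (ℚ × Word n)

coeff : ∀ {n} → QS n → Word n → ℚ
coeff [] w = 0ℚ
coeff ((q , u) ∷ xs) w with vec-dec _≟ᶠ_ u w
... | yes _ = q +ℚ coeff xs w
... | no  _ = coeff xs w

_·_ : ∀ {n} → QS n → QS n → QS n
x · y = concatMap (λ { (p , u) → map (λ { (q , v) → (p *ℚ q , u ∘ₚ v) }) y }) x

_≈_ : ∀ {n} → QS n → QS n → Set
_≈_ {n} x y = (w : Word n) → coeff x w ≡ coeff y w

-- a / b as a rational, for b ≥ 1 (only ever used with b ≥ 1)
_÷ℕ_ : ℕ → ℕ → ℚ
a ÷ℕ zero = 0ℚ
a ÷ℕ suc b = (+ a) Q./ suc b

riffle : ∀ n → ℕ → QS n
riffle n k = map (λ w → (((n + k ∸ des (inv w) ∸ 1) C n) ÷ℕ (k ^ n) , w)) (Sym n)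

cut : ∀ n → QS n
cut n = map (λ i → (1 ÷ℕ n , ζ n ^ₚ i)) (Data.List.upTo n)
  where import Data.List

module Submission where

-- Comparing coefficients, (c·s)·c = c·s says that w ↦ [w](c·s) is invariant under
-- w ↦ w∘ζ, and this holds for s = Σ_w F(d(w⁻¹)) w with an arbitrary weight F.
-- For a permutation w, [w](c·s) is the average over i < n of F(d(w⁻¹∘ζⁱ)), the descent
-- numbers of the n windows of length n of the periodic sequence u(0), u(1), … (indices
-- mod n) with u = w⁻¹; for other words it is 0. Passing from w to w∘ζ replaces u by
-- ζ⁻¹∘u, from which u is obtained by raising every value by one modulo n. Such a shift
-- keeps the descent status of two adjacent values unless one of them is the top value
-- n−1, and tracking these exceptions shows that only the windows starting at the
-- position p of n−1 and at p+1 change: they exchange their descent numbers. Hence the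
-- multiset of window descent numbers, and with it the average, is unchanged.

open import Algebra.Bundles using (CommutativeMonoid; CommutativeSemigroup)
open import Algebra.Core using (Op₂)
open import Algebra.Structures using (IsCommutativeMonoid)
open import Data.Bool using (true; false; if_then_else_)
open import Data.Empty using (⊥-elim)
open import Data.Fin as Fin using (Fin; toℕ; fromℕ; fromℕ<) renaming (_≟_ to _≟ᶠ_)
import Data.Fin.Properties as Finₚ
open import Data.Integer as ℤ using (ℤ)
import Data.Integer.Properties as ℤₚ
import Data.Integer.Tactic.RingSolver as ℤ-Solver
open import Data.List using (List; []; _∷_; _++_; map; concatMap; filter; applyUpTo; upTo)
open import Data.Nat as ℕ
  using (ℕ; zero; suc; _+_; _∸_; _^_; _<_; _≤_; _<ᵇ_; z≤n; s≤s; s≤s⁻¹; z<s; s<s; _%_; NonZero)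
open import Data.Nat.Combinatorics using (_C_)
open import Data.Nat.DivMod
  using (_mod_; m%n<n; n%n≡0; m<n⇒m%n≡m; m%n%n≡m%n; %-distribˡ-+; [m+n]%n≡m%n; m≤n⇒[n∸m]%m≡n%m)
import Data.Nat.Properties as ℕₚ
import Data.Nat.Tactic.RingSolver as ℕ-Solver
open import Data.Product using (∃; _,_)
open import Data.Rational using (ℚ; 0ℚ; 1ℚ; toℚᵘ) renaming (_+_ to _+ℚ_; _*_ to _*ℚ_)
import Data.Rational.Properties as ℚₚ
import Data.Rational.Unnormalised as ℚᵘ
import Data.Rational.Unnormalised.Properties as ℚᵘₚ
open import Data.Sum using (inj₁; inj₂)
open import Data.Unit using (tt)
open import Data.Vec as Vec using (Vec; []; _∷_; lookup; tabulate; allFin; toList; _∷ʳ_)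
open import Data.Vec.Properties
  using (lookup∘tabulate; tabulate∘lookup; tabulate-cong; lookup-allFin; allFin-map; toList-map)
  renaming (≡-dec to vec-dec)
open import Function using (_∘_)
open import Level using (0ℓ)
open import Relation.Binary.PropositionalEquality
open import Relation.Nullary using (Dec; yes; no; ¬_; does)
open import Relation.Unary using (Decidable)

open import Defs

module RangeSum {A : Set} {_∙_ : Op₂ A} {ε : A} (isCM : IsCommutativeMonoid _≡_ _∙_ ε) where
  open IsCommutativeMonoid isCM using (assoc; comm; identityˡ; identityʳ; isCommutativeSemigroup)
  open ≡-Reasoning

  commutativeSemigroup : CommutativeSemigroup 0ℓ 0ℓ
  commutativeSemigroup = record { isCommutativeSemigroup = isCommutativeSemigroup }

  open import Algebra.Properties.CommutativeSemigroup commutativeSemigroup using (interchange)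

  ∑< : ℕ → (ℕ → A) → A
  ∑< zero    f = ε
  ∑< (suc L) f = f 0 ∙ ∑< L (f ∘ suc)

  ∑<-cong : ∀ L {f g : ℕ → A} → (∀ t → t < L → f t ≡ g t) → ∑< L f ≡ ∑< L g
  ∑<-cong zero    f≡g = refl
  ∑<-cong (suc L) f≡g = cong₂ _∙_ (f≡g 0 z<s) (∑<-cong L (λ t t<L → f≡g (suc t) (s<s t<L)))

  ∑<-snoc : ∀ L (f : ℕ → A) → ∑< (suc L) f ≡ ∑< L f ∙ f L
  ∑<-snoc zero    f = trans (identityʳ (f 0)) (sym (identityˡ (f 0)))
  ∑<-snoc (suc L) f = begin
    f 0 ∙ ∑< (suc L) (f ∘ suc)      ≡⟨ cong (f 0 ∙_) (∑<-snoc L (f ∘ suc)) ⟩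
    f 0 ∙ (∑< L (f ∘ suc) ∙ f (suc L)) ≡⟨ assoc (f 0) _ _ ⟨
    ∑< (suc L) f ∙ f (suc L)         ∎

  ∑<-telescope : ∀ L (f f′ g : ℕ → A) → (∀ t → f t ∙ g t ≡ f′ t ∙ g (suc t)) →
                 ∑< L f ∙ g 0 ≡ ∑< L f′ ∙ g L
  ∑<-telescope zero    f f′ g step = refl
  ∑<-telescope (suc L) f f′ g step = begin
    (f 0 ∙ ∑< L (f ∘ suc)) ∙ g 0    ≡⟨ assoc (f 0) _ _ ⟩
    f 0 ∙ (∑< L (f ∘ suc) ∙ g 0)    ≡⟨ cong (f 0 ∙_) (comm _ (g 0)) ⟩
    f 0 ∙ (g 0 ∙ ∑< L (f ∘ suc))    ≡⟨ assoc (f 0) (g 0) _ ⟨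
    (f 0 ∙ g 0) ∙ ∑< L (f ∘ suc)    ≡⟨ cong (_∙ ∑< L (f ∘ suc)) (step 0) ⟩
    (f′ 0 ∙ g 1) ∙ ∑< L (f ∘ suc)   ≡⟨ assoc (f′ 0) (g 1) _ ⟩
    f′ 0 ∙ (g 1 ∙ ∑< L (f ∘ suc))   ≡⟨ cong (f′ 0 ∙_) (comm (g 1) _) ⟩
    f′ 0 ∙ (∑< L (f ∘ suc) ∙ g 1)
      ≡⟨ cong (f′ 0 ∙_) (∑<-telescope L (f ∘ suc) (f′ ∘ suc) (g ∘ suc) (step ∘ suc)) ⟩
    f′ 0 ∙ (∑< L (f′ ∘ suc) ∙ g (suc L)) ≡⟨ assoc (f′ 0) _ _ ⟨
    (f′ 0 ∙ ∑< L (f′ ∘ suc)) ∙ g (suc L) ∎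

  ∑<-rotate : ∀ L (f : ℕ → A) → f L ≡ f 0 → ∑< L (f ∘ suc) ≡ ∑< L f
  ∑<-rotate zero    f fL≡f0 = refl
  ∑<-rotate (suc L) f fL≡f0 = begin
    ∑< (suc L) (f ∘ suc)            ≡⟨ ∑<-snoc L (f ∘ suc) ⟩
    ∑< L (f ∘ suc) ∙ f (suc L)      ≡⟨ cong (∑< L (f ∘ suc) ∙_) fL≡f0 ⟩
    ∑< L (f ∘ suc) ∙ f 0            ≡⟨ comm _ (f 0) ⟩
    ∑< (suc L) f                    ∎

  ∑<-ε : ∀ L → ∑< L (λ _ → ε) ≡ ε
  ∑<-ε zero    = refl
  ∑<-ε (suc L) = trans (identityˡ _) (∑<-ε L)

  ∑<-distrib : ∀ L (f g : ℕ → A) → ∑< L (λ t → f t ∙ g t) ≡ ∑< L f ∙ ∑< L g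
  ∑<-distrib zero    f g = sym (identityˡ ε)
  ∑<-distrib (suc L) f g = begin
    (f 0 ∙ g 0) ∙ ∑< L (λ t → f (suc t) ∙ g (suc t))
      ≡⟨ cong ((f 0 ∙ g 0) ∙_) (∑<-distrib L (f ∘ suc) (g ∘ suc)) ⟩
    (f 0 ∙ g 0) ∙ (∑< L (f ∘ suc) ∙ ∑< L (g ∘ suc)) ≡⟨ interchange (f 0) (g 0) _ _ ⟩
    ∑< (suc L) f ∙ ∑< (suc L) g ∎

  ∑<-shift : ∀ L (f : ℕ → A) → (∀ a → f (a + L) ≡ f a) → ∀ p → ∑< L (λ a → f (a + p)) ≡ ∑< L f
  ∑<-shift L f periodic zero    = ∑<-cong L (λ a _ → cong f (ℕₚ.+-identityʳ a))
  ∑<-shift L f periodic (suc p) = begin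
    ∑< L (λ a → f (a + suc p))      ≡⟨ ∑<-cong L (λ a _ → cong f (ℕₚ.+-suc a p)) ⟩
    ∑< L (λ a → f (suc a + p))      ≡⟨ ∑<-rotate L (λ a → f (a + p)) (periodic′ p) ⟩
    ∑< L (λ a → f (a + p))          ≡⟨ ∑<-shift L f periodic p ⟩
    ∑< L f                          ∎
    where
    periodic′ : ∀ p → f (L + p) ≡ f p
    periodic′ p = trans (cong f (ℕₚ.+-comm L p)) (periodic p)

module ℕ∑ = RangeSum ℕₚ.+-0-isCommutativeMonoid
open RangeSum ℚₚ.+-0-isCommutativeMonoid

∑<-*ˡ : ∀ L x (f : ℕ → ℚ) → ∑< L (λ i → x *ℚ f i) ≡ x *ℚ ∑< L f
∑<-*ˡ zero    x f = sym (ℚₚ.*-zeroʳ x)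
∑<-*ˡ (suc L) x f =
  trans (cong (λ s → x *ℚ f 0 +ℚ s) (∑<-*ˡ L x (f ∘ suc))) (sym (ℚₚ.*-distribˡ-+ x (f 0) _))

toℚᵘ-∑<-1/n : ∀ m k → toℚᵘ (∑< k (λ _ → 1 ÷ℕ suc m)) ℚᵘ.≃ ℚᵘ.mkℚᵘ (ℤ.+ k) m
toℚᵘ-∑<-1/n m zero    = ℚᵘ.*≡* refl
toℚᵘ-∑<-1/n m (suc k) = ℚᵘₚ.≃-trans (ℚₚ.toℚᵘ-homo-+ (1 ÷ℕ suc m) _)
  (ℚᵘₚ.≃-trans (ℚᵘₚ.+-cong (ℚₚ.toℚᵘ-fromℚᵘ (ℚᵘ.mkℚᵘ ℤ.1ℤ m)) (toℚᵘ-∑<-1/n m k))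
               (ℚᵘ.*≡* (cross-multiplied (ℤ.+ suc m) (ℤ.+ k))))
  where
  cross-multiplied : ∀ (a k : ℤ) → (ℤ.1ℤ ℤ.* a ℤ.+ k ℤ.* a) ℤ.* a ≡ (ℤ.1ℤ ℤ.+ k) ℤ.* (a ℤ.* a)
  cross-multiplied = ℤ-Solver.solve-∀

∑<-1/n≡1 : ∀ m → ∑< (suc m) (λ _ → 1 ÷ℕ suc m) ≡ 1ℚ
∑<-1/n≡1 m = ℚₚ.toℚᵘ-injective (ℚᵘₚ.≃-trans (toℚᵘ-∑<-1/n m (suc m))
  (ℚᵘ.*≡* (trans (ℤₚ.*-identityʳ (ℤ.+ suc m)) (sym (ℤₚ.*-identityˡ (ℤ.+ suc m))))))

∑<-mean-const : ∀ m q → ∑< (suc m) (λ _ → (1 ÷ℕ suc m) *ℚ q) ≡ q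
∑<-mean-const m q = begin
  ∑< (suc m) (λ _ → (1 ÷ℕ suc m) *ℚ q)   ≡⟨ ∑<-cong (suc m) (λ _ _ → ℚₚ.*-comm (1 ÷ℕ suc m) q) ⟩
  ∑< (suc m) (λ _ → q *ℚ (1 ÷ℕ suc m))   ≡⟨ ∑<-*ˡ (suc m) q (λ _ → 1 ÷ℕ suc m) ⟩
  q *ℚ ∑< (suc m) (λ _ → 1 ÷ℕ suc m)     ≡⟨ cong (q *ℚ_) (∑<-1/n≡1 m) ⟩
  q *ℚ 1ℚ                                ≡⟨ ℚₚ.*-identityʳ q ⟩
  q                                     ∎
  where open ≡-Reasoning

lookup-∘ₚ : ∀ {n} (σ τ : Word n) x → lookup (σ ∘ₚ τ) x ≡ lookup σ (lookup τ x)
lookup-∘ₚ σ τ = lookup∘tabulate _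

lookup-idₚ : ∀ {n} (x : Fin n) → lookup idₚ x ≡ x
lookup-idₚ = lookup∘tabulate _

Word-ext : ∀ {n} {u v : Word n} → (∀ x → lookup u x ≡ lookup v x) → u ≡ v
Word-ext {u = u} {v} eq = trans (sym (tabulate∘lookup u)) (trans (tabulate-cong eq) (tabulate∘lookup v))

∘ₚ-assoc : ∀ {n} (σ τ ρ : Word n) → (σ ∘ₚ τ) ∘ₚ ρ ≡ σ ∘ₚ (τ ∘ₚ ρ)
∘ₚ-assoc σ τ ρ = Word-ext λ x → begin
  lookup ((σ ∘ₚ τ) ∘ₚ ρ) x          ≡⟨ lookup-∘ₚ (σ ∘ₚ τ) ρ x ⟩
  lookup (σ ∘ₚ τ) (lookup ρ x)      ≡⟨ lookup-∘ₚ σ τ (lookup ρ x) ⟩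
  lookup σ (lookup τ (lookup ρ x))  ≡⟨ cong (lookup σ) (lookup-∘ₚ τ ρ x) ⟨
  lookup σ (lookup (τ ∘ₚ ρ) x)      ≡⟨ lookup-∘ₚ σ (τ ∘ₚ ρ) x ⟨
  lookup (σ ∘ₚ (τ ∘ₚ ρ)) x          ∎
  where open ≡-Reasoning

∘ₚ-identityˡ : ∀ {n} (σ : Word n) → idₚ ∘ₚ σ ≡ σ
∘ₚ-identityˡ σ = Word-ext λ x → trans (lookup-∘ₚ idₚ σ x) (lookup-idₚ (lookup σ x))

∘ₚ-identityʳ : ∀ {n} (σ : Word n) → σ ∘ₚ idₚ ≡ σ
∘ₚ-identityʳ σ = Word-ext λ x → trans (lookup-∘ₚ σ idₚ x) (cong (lookup σ) (lookup-idₚ x))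

^ₚ-suc-comm : ∀ {n} (σ : Word n) a → (σ ^ₚ a) ∘ₚ σ ≡ σ ^ₚ suc a
^ₚ-suc-comm σ zero    = trans (∘ₚ-identityˡ σ) (sym (∘ₚ-identityʳ σ))
^ₚ-suc-comm σ (suc a) = trans (∘ₚ-assoc σ (σ ^ₚ a) σ) (cong (σ ∘ₚ_) (^ₚ-suc-comm σ a))

IsPerm-idₚ : ∀ {n} → IsPerm (idₚ {n})
IsPerm-idₚ i j eq = trans (sym (lookup-idₚ i)) (trans eq (lookup-idₚ j))

IsPerm-∘ₚ : ∀ {n} (σ τ : Word n) → IsPerm σ → IsPerm τ → IsPerm (σ ∘ₚ τ)
IsPerm-∘ₚ σ τ σ-inj τ-inj i j eq =
  τ-inj i j (σ-inj _ _ (trans (sym (lookup-∘ₚ σ τ i)) (trans eq (lookup-∘ₚ σ τ j))))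

IsPerm-^ₚ : ∀ {n} (σ : Word n) → IsPerm σ → ∀ a → IsPerm (σ ^ₚ a)
IsPerm-^ₚ σ σ-inj zero    = IsPerm-idₚ
IsPerm-^ₚ σ σ-inj (suc a) = IsPerm-∘ₚ σ (σ ^ₚ a) σ-inj (IsPerm-^ₚ σ σ-inj a)

leftInverse⇒IsPerm : ∀ {n} (ρ σ : Word n) → ρ ∘ₚ σ ≡ idₚ → IsPerm σ
leftInverse⇒IsPerm ρ σ ρσ≡id i j eq = begin
  i                           ≡⟨ at i ⟨
  lookup ρ (lookup σ i)       ≡⟨ cong (lookup ρ) eq ⟩
  lookup ρ (lookup σ j)       ≡⟨ at j ⟩
  j                           ∎
  where
  open ≡-Reasoning
  at : ∀ x → lookup ρ (lookup σ x) ≡ x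
  at x = trans (sym (lookup-∘ₚ ρ σ x)) (trans (cong (λ π → lookup π x) ρσ≡id) (lookup-idₚ x))

IsPerm⇒surjective : ∀ {n} (σ : Word n) → IsPerm σ → ∀ y → ∃ λ x → lookup σ x ≡ y
IsPerm⇒surjective {suc n} σ σ-inj y with Finₚ.any? (λ x → lookup σ x ≟ᶠ y)
... | yes hit = hit
... | no miss with Finₚ.pigeonhole ℕₚ.≤-refl (λ x → Fin.punchOut (λ eq → miss (x , sym eq)))
...   | i , j , i<j , eq = ⊥-elim (Finₚ.<⇒≢ i<j (σ-inj i j
          (Finₚ.punchOut-injective (λ e → miss (i , sym e)) (λ e → miss (j , sym e)) eq)))

findPre-correct : ∀ {n L} (σ : Word n) y (xs : Vec (Fin n) L) dflt i →
                  lookup σ (lookup xs i) ≡ y → lookup σ (findPre σ y xs dflt) ≡ y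
findPre-correct σ y (x ∷ xs) dflt i hit with lookup σ x ≟ᶠ y
... | yes found = found
findPre-correct σ y (x ∷ xs) dflt Fin.zero    hit | no miss = ⊥-elim (miss hit)
findPre-correct σ y (x ∷ xs) dflt (Fin.suc i) hit | no _    = findPre-correct σ y xs dflt i hit

lookup-inv : ∀ {n} (σ : Word n) → IsPerm σ → ∀ y → lookup σ (lookup (inv σ) y) ≡ y
lookup-inv {n} σ σ-inj y with IsPerm⇒surjective σ σ-inj y
... | x , σx≡y = trans (cong (lookup σ) (lookup∘tabulate _ y))
                       (findPre-correct σ y (allFin n) y x (trans (cong (lookup σ) (lookup-allFin x)) σx≡y))

inv-inverseʳ : ∀ {n} (σ : Word n) → IsPerm σ → σ ∘ₚ inv σ ≡ idₚ
inv-inverseʳ σ σ-inj = Word-ext λ y →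
  trans (lookup-∘ₚ σ (inv σ) y) (trans (lookup-inv σ σ-inj y) (sym (lookup-idₚ y)))

inv-inverseˡ : ∀ {n} (σ : Word n) → IsPerm σ → inv σ ∘ₚ σ ≡ idₚ
inv-inverseˡ σ σ-inj = Word-ext λ x →
  trans (lookup-∘ₚ (inv σ) σ x) (trans (σ-inj _ _ (lookup-inv σ σ-inj (lookup σ x))) (sym (lookup-idₚ x)))

IsPerm-inv : ∀ {n} (σ : Word n) → IsPerm σ → IsPerm (inv σ)
IsPerm-inv σ σ-inj = leftInverse⇒IsPerm σ (inv σ) (inv-inverseʳ σ σ-inj)

∘ₚ-moveˡ : ∀ {n} (σ u w : Word n) → IsPerm σ → σ ∘ₚ u ≡ w → u ≡ inv σ ∘ₚ w
∘ₚ-moveˡ σ u w σ-inj σu≡w = begin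
  u                       ≡⟨ ∘ₚ-identityˡ u ⟨
  idₚ ∘ₚ u                ≡⟨ cong (_∘ₚ u) (inv-inverseˡ σ σ-inj) ⟨
  (inv σ ∘ₚ σ) ∘ₚ u       ≡⟨ ∘ₚ-assoc (inv σ) σ u ⟩
  inv σ ∘ₚ (σ ∘ₚ u)       ≡⟨ cong (inv σ ∘ₚ_) σu≡w ⟩
  inv σ ∘ₚ w              ∎
  where open ≡-Reasoning

∘ₚ-moveˡ⁻ : ∀ {n} (σ u w : Word n) → IsPerm σ → u ≡ inv σ ∘ₚ w → σ ∘ₚ u ≡ w
∘ₚ-moveˡ⁻ σ u w σ-inj refl = begin
  σ ∘ₚ (inv σ ∘ₚ w)       ≡⟨ ∘ₚ-assoc σ (inv σ) w ⟨
  (σ ∘ₚ inv σ) ∘ₚ w       ≡⟨ cong (_∘ₚ w) (inv-inverseʳ σ σ-inj) ⟩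
  idₚ ∘ₚ w                ≡⟨ ∘ₚ-identityˡ w ⟩
  w                       ∎
  where open ≡-Reasoning

∘ₚ-moveʳ : ∀ {n} (σ u w : Word n) → IsPerm σ → u ∘ₚ σ ≡ w → u ≡ w ∘ₚ inv σ
∘ₚ-moveʳ σ u w σ-inj uσ≡w = begin
  u                       ≡⟨ ∘ₚ-identityʳ u ⟨
  u ∘ₚ idₚ                ≡⟨ cong (u ∘ₚ_) (inv-inverseʳ σ σ-inj) ⟨
  u ∘ₚ (σ ∘ₚ inv σ)       ≡⟨ ∘ₚ-assoc u σ (inv σ) ⟨
  (u ∘ₚ σ) ∘ₚ inv σ       ≡⟨ cong (_∘ₚ inv σ) uσ≡w ⟩
  w ∘ₚ inv σ              ∎
  where open ≡-Reasoning

∘ₚ-moveʳ⁻ : ∀ {n} (σ u w : Word n) → IsPerm σ → u ≡ w ∘ₚ inv σ → u ∘ₚ σ ≡ w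
∘ₚ-moveʳ⁻ σ u w σ-inj refl = begin
  (w ∘ₚ inv σ) ∘ₚ σ       ≡⟨ ∘ₚ-assoc w (inv σ) σ ⟩
  w ∘ₚ (inv σ ∘ₚ σ)       ≡⟨ cong (w ∘ₚ_) (inv-inverseˡ σ σ-inj) ⟩
  w ∘ₚ idₚ                ≡⟨ ∘ₚ-identityʳ w ⟩
  w                       ∎
  where open ≡-Reasoning

inv-unique : ∀ {n} (σ τ : Word n) → IsPerm σ → σ ∘ₚ τ ≡ idₚ → inv σ ≡ τ
inv-unique σ τ σ-inj στ≡id = sym (trans (∘ₚ-moveˡ σ τ idₚ σ-inj στ≡id) (∘ₚ-identityʳ (inv σ)))

inv-∘ₚ : ∀ {n} (σ τ : Word n) → IsPerm σ → IsPerm τ → inv (σ ∘ₚ τ) ≡ inv τ ∘ₚ inv σ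
inv-∘ₚ σ τ σ-inj τ-inj = inv-unique (σ ∘ₚ τ) (inv τ ∘ₚ inv σ) (IsPerm-∘ₚ σ τ σ-inj τ-inj) (begin
  (σ ∘ₚ τ) ∘ₚ (inv τ ∘ₚ inv σ)   ≡⟨ ∘ₚ-assoc σ τ (inv τ ∘ₚ inv σ) ⟩
  σ ∘ₚ (τ ∘ₚ (inv τ ∘ₚ inv σ))   ≡⟨ cong (σ ∘ₚ_) (∘ₚ-moveˡ⁻ τ (inv τ ∘ₚ inv σ) (inv σ) τ-inj refl) ⟩
  σ ∘ₚ inv σ                     ≡⟨ inv-inverseʳ σ σ-inj ⟩
  idₚ                            ∎)
  where open ≡-Reasoning

inv-involutive : ∀ {n} (σ : Word n) → IsPerm σ → inv (inv σ) ≡ σ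
inv-involutive σ σ-inj = inv-unique (inv σ) σ (IsPerm-inv σ σ-inj) (inv-inverseˡ σ σ-inj)

lookup-∷ʳ-last : ∀ {A : Set} {m} (xs : Vec A m) z (x : Fin (suc m)) → toℕ x ≡ m → lookup (xs ∷ʳ z) x ≡ z
lookup-∷ʳ-last []       z Fin.zero    _    = refl
lookup-∷ʳ-last (y ∷ xs) z (Fin.suc x) x≡m = lookup-∷ʳ-last xs z x (ℕₚ.suc-injective x≡m)

lookup-∷ʳ-init : ∀ {A : Set} {m} (xs : Vec A m) z (x : Fin (suc m)) (x<m : toℕ x < m) →
                 lookup (xs ∷ʳ z) x ≡ lookup xs (fromℕ< x<m)
lookup-∷ʳ-init (y ∷ xs) z Fin.zero    _         = refl
lookup-∷ʳ-init (y ∷ xs) z (Fin.suc x) (s≤s x<m) = lookup-∷ʳ-init xs z x x<m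

toℕ-lookup-ζ : ∀ m (x : Fin (suc m)) → toℕ (lookup (ζ (suc m)) x) ≡ suc (toℕ x) % suc m
toℕ-lookup-ζ m x with toℕ x ℕ.≟ m
... | yes x≡m = begin
  toℕ (lookup (ζ (suc m)) x)   ≡⟨ cong toℕ (lookup-∷ʳ-last (tabulate Fin.suc) Fin.zero x x≡m) ⟩
  0                            ≡⟨ n%n≡0 (suc m) ⟨
  suc m % suc m                ≡⟨ cong (λ y → suc y % suc m) x≡m ⟨
  suc (toℕ x) % suc m          ∎
  where open ≡-Reasoning
... | no x≢m = begin
  toℕ (lookup (ζ (suc m)) x)                   ≡⟨ cong toℕ (lookup-∷ʳ-init (tabulate Fin.suc) Fin.zero x x<m) ⟩
  toℕ (lookup (tabulate Fin.suc) (fromℕ< x<m)) ≡⟨ cong toℕ (lookup∘tabulate Fin.suc (fromℕ< x<m)) ⟩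
  suc (toℕ (fromℕ< x<m))                       ≡⟨ cong suc (Finₚ.toℕ-fromℕ< x<m) ⟩
  suc (toℕ x)                                  ≡⟨ m<n⇒m%n≡m (s≤s x<m) ⟨
  suc (toℕ x) % suc m                          ∎
  where
  open ≡-Reasoning
  x<m : toℕ x < m
  x<m = ℕₚ.≤∧≢⇒< (s≤s⁻¹ (Finₚ.toℕ<n x)) x≢m

[1+m%n]%n≡[1+m]%n : ∀ m n .{{_ : NonZero n}} → suc (m % n) % n ≡ suc m % n
[1+m%n]%n≡[1+m]%n m n = begin
  (1 + m % n) % n                ≡⟨ %-distribˡ-+ 1 (m % n) n ⟩
  (1 % n + m % n % n) % n        ≡⟨ cong (λ r → (1 % n + r) % n) (m%n%n≡m%n m n) ⟩
  (1 % n + m % n) % n            ≡⟨ %-distribˡ-+ 1 m n ⟨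
  (1 + m) % n                    ∎
  where open ≡-Reasoning

[d+p]%n≢p : ∀ {n} .{{_ : NonZero n}} {d p} → p < n → 0 < d → d < n → (d + p) % n ≢ p
[d+p]%n≢p {n} {d} {p} p<n 0<d d<n eq with d + p ℕ.<? n
... | yes d+p<n = ℕₚ.<⇒≢ (ℕₚ.m<n+m p 0<d) (sym (trans (sym (m<n⇒m%n≡m d+p<n)) eq))
... | no  d+p≮n = ℕₚ.<⇒≢ d<n (ℕₚ.+-cancelʳ-≡ p d n (begin
  d + p               ≡⟨ ℕₚ.m∸n+n≡m n≤d+p ⟨
  (d + p ∸ n) + n     ≡⟨ cong (_+ n) wrapped≡p ⟩
  p + n               ≡⟨ ℕₚ.+-comm p n ⟩
  n + p               ∎))
  where
  open ≡-Reasoning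
  n≤d+p : n ≤ d + p
  n≤d+p = ℕₚ.≮⇒≥ d+p≮n
  wrapped<n : d + p ∸ n < n
  wrapped<n = ℕₚ.+-cancelʳ-< n (d + p ∸ n) n
    (subst (_< n + n) (sym (ℕₚ.m∸n+n≡m n≤d+p)) (ℕₚ.+-mono-< d<n p<n))
  wrapped≡p : d + p ∸ n ≡ p
  wrapped≡p = begin
    d + p ∸ n             ≡⟨ m<n⇒m%n≡m wrapped<n ⟨
    (d + p ∸ n) % n       ≡⟨ m≤n⇒[n∸m]%m≡n%m n≤d+p ⟩
    (d + p) % n           ≡⟨ eq ⟩
    p                     ∎

toℕ-lookup-ζ^ : ∀ m a (x : Fin (suc m)) → toℕ (lookup (ζ (suc m) ^ₚ a) x) ≡ (toℕ x + a) % suc m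
toℕ-lookup-ζ^ m zero    x = begin
  toℕ (lookup idₚ x)            ≡⟨ cong toℕ (lookup-idₚ x) ⟩
  toℕ x                         ≡⟨ m<n⇒m%n≡m (Finₚ.toℕ<n x) ⟨
  toℕ x % suc m                 ≡⟨ cong (_% suc m) (ℕₚ.+-identityʳ (toℕ x)) ⟨
  (toℕ x + 0) % suc m           ∎
  where open ≡-Reasoning
toℕ-lookup-ζ^ m (suc a) x = begin
  toℕ (lookup (ζ (suc m) ∘ₚ (ζ (suc m) ^ₚ a)) x)        ≡⟨ cong toℕ (lookup-∘ₚ (ζ (suc m)) (ζ (suc m) ^ₚ a) x) ⟩
  toℕ (lookup (ζ (suc m)) (lookup (ζ (suc m) ^ₚ a) x))  ≡⟨ toℕ-lookup-ζ m _ ⟩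
  suc (toℕ (lookup (ζ (suc m) ^ₚ a) x)) % suc m         ≡⟨ cong (λ r → suc r % suc m) (toℕ-lookup-ζ^ m a x) ⟩
  suc ((toℕ x + a) % suc m) % suc m                     ≡⟨ [1+m%n]%n≡[1+m]%n (toℕ x + a) (suc m) ⟩
  suc (toℕ x + a) % suc m                               ≡⟨ cong (_% suc m) (ℕₚ.+-suc (toℕ x) a) ⟨
  (toℕ x + suc a) % suc m                               ∎
  where open ≡-Reasoning

lookup-ζ^ : ∀ m a (x : Fin (suc m)) → lookup (ζ (suc m) ^ₚ a) x ≡ (toℕ x + a) mod suc m
lookup-ζ^ m a x = Finₚ.toℕ-injective
  (trans (toℕ-lookup-ζ^ m a x) (sym (Finₚ.toℕ-fromℕ< (m%n<n (toℕ x + a) (suc m)))))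

ζ^n≡idₚ : ∀ m → ζ (suc m) ^ₚ suc m ≡ idₚ
ζ^n≡idₚ m = Word-ext λ x → Finₚ.toℕ-injective (begin
  toℕ (lookup (ζ (suc m) ^ₚ suc m) x)   ≡⟨ toℕ-lookup-ζ^ m (suc m) x ⟩
  (toℕ x + suc m) % suc m               ≡⟨ [m+n]%n≡m%n (toℕ x) (suc m) ⟩
  toℕ x % suc m                         ≡⟨ m<n⇒m%n≡m (Finₚ.toℕ<n x) ⟩
  toℕ x                                 ≡⟨ cong toℕ (lookup-idₚ x) ⟨
  toℕ (lookup idₚ x)                    ∎)
  where open ≡-Reasoning

IsPerm-ζ : ∀ m → IsPerm (ζ (suc m))
IsPerm-ζ m = leftInverse⇒IsPerm (ζ (suc m) ^ₚ m) (ζ (suc m)) (trans (^ₚ-suc-comm (ζ (suc m)) m) (ζ^n≡idₚ m))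

IsPerm-ζ^ : ∀ m a → IsPerm (ζ (suc m) ^ₚ a)
IsPerm-ζ^ m = IsPerm-^ₚ (ζ (suc m)) (IsPerm-ζ m)

-- Descents of windows of a periodic sequence

desc : ℕ → ℕ → ℕ
desc a b = if b <ᵇ a then 1 else 0

desc-> : ∀ {a b} → b < a → desc a b ≡ 1
desc-> {a} {b} b<a with b <ᵇ a | ℕₚ.<⇒<ᵇ b<a
... | true | _ = refl

desc-≤ : ∀ {a b} → a ≤ b → desc a b ≡ 0
desc-≤ {a} {b} a≤b with b <ᵇ a | ℕₚ.<ᵇ⇒< b a
... | false | _   = refl
... | true  | b<a = ⊥-elim (ℕₚ.≤⇒≯ a≤b (b<a tt))

descents : ℕ → (ℕ → ℕ) → ℕ
descents L Y = ℕ∑.∑< L (λ t → desc (Y t) (Y (suc t)))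

desVec-tabulate : ∀ {N} m (g : ℕ → Fin N) → desVec (tabulate {n = suc m} (g ∘ toℕ)) ≡ descents m (toℕ ∘ g)
desVec-tabulate zero    g = refl
desVec-tabulate (suc m) g = cong (desc (toℕ (g 0)) (toℕ (g 1)) +_) (desVec-tabulate m (g ∘ suc))

windowDescents : ℕ → (ℕ → ℕ) → ℕ → ℕ
windowDescents L X a = descents L (λ t → X (t + a))

windowDescents-cong : ∀ L {X Y : ℕ → ℕ} → (∀ s → X s ≡ Y s) →
                      ∀ a → windowDescents L X a ≡ windowDescents L Y a
windowDescents-cong L X≗Y a = ℕ∑.∑<-cong L (λ t _ → cong₂ desc (X≗Y (t + a)) (X≗Y (suc t + a)))

windowDescents-periodic : ∀ L (X : ℕ → ℕ) → (∀ s → X (s + suc L) ≡ X s) →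
                          ∀ a → windowDescents L X (a + suc L) ≡ windowDescents L X a
windowDescents-periodic L X periodic a = ℕ∑.∑<-cong L (λ t _ → cong₂ desc (shift t) (shift (suc t)))
  where
  shift : ∀ t → X (t + (a + suc L)) ≡ X (t + a)
  shift t = trans (cong X (sym (ℕₚ.+-assoc t a (suc L)))) (periodic (t + a))

windowDescents-step : ∀ L (X : ℕ → ℕ) a →
  windowDescents L X a + desc (X (L + a)) (X (suc L + a)) ≡ desc (X a) (X (suc a)) + windowDescents L X (suc a)
windowDescents-step L X a = begin
  ℕ∑.∑< L h + h L                  ≡⟨ ℕ∑.∑<-snoc L h ⟨
  h 0 + ℕ∑.∑< L (h ∘ suc)          ≡⟨ cong (h 0 +_) (ℕ∑.∑<-cong L (λ t _ → cong₂ desc (shift t) (shift (suc t)))) ⟩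
  h 0 + windowDescents L X (suc a)  ∎
  where
  open ≡-Reasoning
  h : ℕ → ℕ
  h t = desc (X (t + a)) (X (suc t + a))
  shift : ∀ t → X (suc t + a) ≡ X (t + suc a)
  shift t = cong X (sym (ℕₚ.+-suc t a))

cyclicValues : ∀ m → Word (suc m) → ℕ → ℕ
cyclicValues m u s = toℕ (lookup u (s mod suc m))

des-∘ζ^ : ∀ m (u : Word (suc m)) a → des (u ∘ₚ (ζ (suc m) ^ₚ a)) ≡ windowDescents m (cyclicValues m u) a
des-∘ζ^ m u a = trans
  (cong desVec (tabulate-cong {f = λ x → lookup u (lookup (ζ (suc m) ^ₚ a) x)} (cong (lookup u) ∘ lookup-ζ^ m a)))
  (desVec-tabulate m (λ t → lookup u ((t + a) mod suc m)))

-- Raising the values of a periodic sequence cyclically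

atTop : ℕ → ℕ → ℕ
atTop M y with y ℕ.≟ M
... | yes _ = 1
... | no  _ = 0

atTop-≡ : ∀ M → atTop M M ≡ 1
atTop-≡ M with M ℕ.≟ M
... | yes _   = refl
... | no M≢M = ⊥-elim (M≢M refl)

atTop-≢ : ∀ {M y} → y ≢ M → atTop M y ≡ 0
atTop-≢ {M} {y} y≢M with y ℕ.≟ M
... | yes y≡M = ⊥-elim (y≢M y≡M)
... | no  _   = refl

-- atTop records the only pairs whose descent status changes, so that the identity
-- telescopes along a window.
desc-cycleSucc : ∀ M x y → x ≤ M → y ≤ M →
                 desc (suc x % suc M) (suc y % suc M) + atTop M x ≡ desc x y + atTop M y
desc-cycleSucc M x y x≤M y≤M with ℕₚ.m≤n⇒m<n∨m≡n x≤M | ℕₚ.m≤n⇒m<n∨m≡n y≤M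
... | inj₂ refl | inj₂ refl =
  cong (_+ atTop x x) (trans (desc-≤ {suc x % suc x} ℕₚ.≤-refl) (sym (desc-≤ {x} ℕₚ.≤-refl)))
... | inj₂ refl | inj₁ y<M = begin
  desc (suc M % suc M) (suc y % suc M) + atTop M M
    ≡⟨ cong₂ (λ a b → desc a b + atTop M M) (n%n≡0 (suc M)) (m<n⇒m%n≡m (s≤s y<M)) ⟩
  desc 0 (suc y) + atTop M M
    ≡⟨ atTop-≡ M ⟩
  1
    ≡⟨ cong₂ _+_ (desc-> y<M) (atTop-≢ (ℕₚ.<⇒≢ y<M)) ⟨
  desc M y + atTop M y ∎
  where open ≡-Reasoning
... | inj₁ x<M | inj₂ refl = begin
  desc (suc x % suc M) (suc M % suc M) + atTop M x
    ≡⟨ cong₂ (λ a b → desc a b + atTop M x) (m<n⇒m%n≡m (s≤s x<M)) (n%n≡0 (suc M)) ⟩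
  desc (suc x) 0 + atTop M x
    ≡⟨ cong (1 +_) (atTop-≢ (ℕₚ.<⇒≢ x<M)) ⟩
  1
    ≡⟨ cong₂ _+_ (desc-≤ x≤M) (atTop-≡ M) ⟨
  desc x M + atTop M M ∎
  where open ≡-Reasoning
... | inj₁ x<M | inj₁ y<M = begin
  desc (suc x % suc M) (suc y % suc M) + atTop M x
    ≡⟨ cong₂ (λ a b → desc a b + atTop M x) (m<n⇒m%n≡m (s≤s x<M)) (m<n⇒m%n≡m (s≤s y<M)) ⟩
  desc (suc x) (suc y) + atTop M x
    ≡⟨ cong₂ _+_ refl (trans (atTop-≢ (ℕₚ.<⇒≢ x<M)) (sym (atTop-≢ (ℕₚ.<⇒≢ y<M)))) ⟩
  desc x y + atTop M y ∎
  where open ≡-Reasoning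

module CyclicWindows (r : ℕ) (U : ℕ → ℕ)
  (U≤M : ∀ s → U s ≤ suc r)
  (U-periodic : ∀ s → U (s + suc (suc r)) ≡ U s)
  (p : ℕ) (U[p]≡M : U p ≡ suc r)
  (U≢M : ∀ j → j < suc r → U (suc j + p) ≢ suc r) where

  M n : ℕ
  M = suc r
  n = suc M

  V : ℕ → ℕ
  V s = suc (U s) % n

  W : (ℕ → ℕ) → ℕ → ℕ
  W = windowDescents M

  U[n+s]≡U[s] : ∀ s → U (n + s) ≡ U s
  U[n+s]≡U[s] s = trans (cong U (ℕₚ.+-comm n s)) (U-periodic s)

  W-telescope : ∀ a → W V a + atTop M (U a) ≡ W U a + atTop M (U (M + a))
  W-telescope a = ℕ∑.∑<-telescope M _ _ (λ t → atTop M (U (t + a)))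
    (λ t → desc-cycleSucc M (U (t + a)) (U (suc t + a)) (U≤M _) (U≤M _))

  W-U-at-p : W U p ≡ 1 + W U (suc p)
  W-U-at-p = begin
    W U p                                               ≡⟨ ℕₚ.+-identityʳ (W U p) ⟨
    W U p + 0                                           ≡⟨ cong (W U p +_) (desc-≤ (subst (U (M + p) ≤_) (sym U[n+p]≡M) (U≤M _))) ⟨
    W U p + desc (U (M + p)) (U (n + p))                ≡⟨ windowDescents-step M U p ⟩
    desc (U p) (U (suc p)) + W U (suc p)                ≡⟨ cong (_+ W U (suc p)) (trans (cong (λ y → desc y (U (suc p))) U[p]≡M) (desc-> U[1+p]<M)) ⟩
    1 + W U (suc p)                                     ∎
    where
    open ≡-Reasoning
    U[n+p]≡M : U (n + p) ≡ M
    U[n+p]≡M = trans (U[n+s]≡U[s] p) U[p]≡M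
    U[1+p]<M : U (suc p) < M
    U[1+p]<M = ℕₚ.≤∧≢⇒< (U≤M _) (U≢M 0 (s≤s z≤n))

  W-V-at-p : W V p ≡ W U (suc p)
  W-V-at-p = ℕₚ.+-cancelʳ-≡ 1 _ _ (begin
    W V p + 1                      ≡⟨ cong (W V p +_) (trans (cong (atTop M) U[p]≡M) (atTop-≡ M)) ⟨
    W V p + atTop M (U p)          ≡⟨ W-telescope p ⟩
    W U p + atTop M (U (M + p))    ≡⟨ cong (W U p +_) (atTop-≢ (U≢M r ℕₚ.≤-refl)) ⟩
    W U p + 0                      ≡⟨ ℕₚ.+-identityʳ (W U p) ⟩
    W U p                          ≡⟨ W-U-at-p ⟩
    1 + W U (suc p)                ≡⟨ ℕₚ.+-comm 1 _ ⟩
    W U (suc p) + 1                ∎)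
    where open ≡-Reasoning

  W-V-at-suc-p : W V (suc p) ≡ W U p
  W-V-at-suc-p = begin
    W V (suc p)                           ≡⟨ ℕₚ.+-identityʳ (W V (suc p)) ⟨
    W V (suc p) + 0                       ≡⟨ cong (W V (suc p) +_) (atTop-≢ (U≢M 0 (s≤s z≤n))) ⟨
    W V (suc p) + atTop M (U (suc p))     ≡⟨ W-telescope (suc p) ⟩
    W U (suc p) + atTop M (U (M + suc p)) ≡⟨ cong (W U (suc p) +_) (trans (cong (atTop M) U[M+1+p]≡M) (atTop-≡ M)) ⟩
    W U (suc p) + 1                       ≡⟨ ℕₚ.+-comm _ 1 ⟩
    1 + W U (suc p)                       ≡⟨ W-U-at-p ⟨
    W U p                                 ∎
    where
    open ≡-Reasoning
    U[M+1+p]≡M : U (M + suc p) ≡ M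
    U[M+1+p]≡M = trans (cong U (ℕₚ.+-suc M p)) (trans (U[n+s]≡U[s] p) U[p]≡M)

  W-V-elsewhere : ∀ j → j < r → W V (suc (suc j) + p) ≡ W U (suc (suc j) + p)
  W-V-elsewhere j j<r = ℕₚ.+-cancelʳ-≡ 0 _ _ (begin
    W V a + 0                   ≡⟨ cong (W V a +_) (atTop-≢ (U≢M (suc j) (s≤s j<r))) ⟨
    W V a + atTop M (U a)       ≡⟨ W-telescope a ⟩
    W U a + atTop M (U (M + a)) ≡⟨ cong (W U a +_) (atTop-≢ U[M+a]≢M) ⟩
    W U a + 0                   ∎)
    where
    open ≡-Reasoning
    a : ℕ
    a = suc (suc j) + p
    U[M+a]≢M : U (M + a) ≢ M
    U[M+a]≢M = subst (_≢ M) (trans (sym (U-periodic (suc j + p))) (cong U (arith j p r)))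
                     (U≢M j (ℕₚ.m<n⇒m<1+n j<r))
      where
      arith : ∀ j p r → suc j + p + suc (suc r) ≡ suc r + (suc (suc j) + p)
      arith = ℕ-Solver.solve-∀

  ∑<-W-V≡∑<-W-U : ∀ (F : ℕ → ℚ) → ∑< n (F ∘ W V) ≡ ∑< n (F ∘ W U)
  ∑<-W-V≡∑<-W-U F = begin
    ∑< n (F ∘ W V)
      ≡⟨ ∑<-shift n (F ∘ W V) (cong F ∘ windowDescents-periodic M V (cong (λ y → suc y % n) ∘ U-periodic)) p ⟨
    F (W V p) +ℚ (F (W V (suc p)) +ℚ ∑< r (λ j → F (W V (suc (suc j) + p))))
      ≡⟨ cong₂ (λ x y → x +ℚ (y +ℚ ∑< r (λ j → F (W V (suc (suc j) + p))))) (cong F W-V-at-p) (cong F W-V-at-suc-p) ⟩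
    F (W U (suc p)) +ℚ (F (W U p) +ℚ ∑< r (λ j → F (W V (suc (suc j) + p))))
      ≡⟨ cong (λ z → F (W U (suc p)) +ℚ (F (W U p) +ℚ z)) (∑<-cong r (λ j j<r → cong F (W-V-elsewhere j j<r))) ⟩
    F (W U (suc p)) +ℚ (F (W U p) +ℚ ∑< r (λ j → F (W U (suc (suc j) + p))))
      ≡⟨ x∙yz≈y∙xz (F (W U (suc p))) (F (W U p)) _ ⟩
    F (W U p) +ℚ (F (W U (suc p)) +ℚ ∑< r (λ j → F (W U (suc (suc j) + p))))
      ≡⟨ ∑<-shift n (F ∘ W U) (cong F ∘ windowDescents-periodic M U U-periodic) p ⟩
    ∑< n (F ∘ W U) ∎
    where
    open ≡-Reasoning

    open import Algebra.Properties.CommutativeSemigroup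
      (CommutativeMonoid.commutativeSemigroup ℚₚ.+-0-commutativeMonoid) using (x∙yz≈y∙xz)

cyclicValues-ζ∘ₚ : ∀ m (u : Word (suc m)) s →
                   cyclicValues m (ζ (suc m) ∘ₚ u) s ≡ suc (cyclicValues m u s) % suc m
cyclicValues-ζ∘ₚ m u s = trans (cong toℕ (lookup-∘ₚ (ζ (suc m)) u (s mod suc m))) (toℕ-lookup-ζ m _)

∑<-des-rotations-ζ∘ₚ : ∀ m (u : Word (suc m)) → IsPerm u → ∀ (F : ℕ → ℚ) →
             ∑< (suc m) (λ a → F (des ((ζ (suc m) ∘ₚ u) ∘ₚ (ζ (suc m) ^ₚ a)))) ≡
             ∑< (suc m) (λ a → F (des (u ∘ₚ (ζ (suc m) ^ₚ a))))
∑<-des-rotations-ζ∘ₚ zero    u u-inj F = refl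
∑<-des-rotations-ζ∘ₚ (suc r) u u-inj F with IsPerm⇒surjective u u-inj (fromℕ (suc r))
... | x , u[x]≡M = begin
  ∑< n (λ a → F (des ((ζ n ∘ₚ u) ∘ₚ (ζ n ^ₚ a))))
    ≡⟨ ∑<-cong n (λ a _ → cong F (trans (des-∘ζ^ (suc r) (ζ n ∘ₚ u) a)
                                          (windowDescents-cong (suc r) (cyclicValues-ζ∘ₚ (suc r) u) a))) ⟩
  ∑< n (F ∘ C.W C.V)
    ≡⟨ C.∑<-W-V≡∑<-W-U F ⟩
  ∑< n (F ∘ C.W U)
    ≡⟨ ∑<-cong n (λ a _ → cong F (des-∘ζ^ (suc r) u a)) ⟨
  ∑< n (λ a → F (des (u ∘ₚ (ζ n ^ₚ a)))) ∎
  where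
  open ≡-Reasoning

  n : ℕ
  n = suc (suc r)
  U : ℕ → ℕ
  U = cyclicValues (suc r) u
  p : ℕ
  p = toℕ x
  U[p]≡M : U p ≡ suc r
  U[p]≡M = trans (cong (toℕ ∘ lookup u) (Finₚ.toℕ-injective x-mod))
                 (trans (cong toℕ u[x]≡M) (Finₚ.toℕ-fromℕ (suc r)))
    where
    x-mod : toℕ (p mod n) ≡ toℕ x
    x-mod = trans (Finₚ.toℕ-fromℕ< (m%n<n p n)) (m<n⇒m%n≡m (Finₚ.toℕ<n x))
  M≡u[x] : suc r ≡ toℕ (lookup u x)
  M≡u[x] = trans (sym (Finₚ.toℕ-fromℕ (suc r))) (cong toℕ (sym u[x]≡M))
  U≢M : ∀ j → j < suc r → U (suc j + p) ≢ suc r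
  U≢M j j<M U≡M = [d+p]%n≢p (Finₚ.toℕ<n x) (s≤s z≤n) (s≤s j<M) (begin
    (suc j + p) % n            ≡⟨ Finₚ.toℕ-fromℕ< (m%n<n (suc j + p) n) ⟨
    toℕ ((suc j + p) mod n)    ≡⟨ cong toℕ (u-inj _ x (Finₚ.toℕ-injective (trans U≡M M≡u[x]))) ⟩
    p                          ∎)
  U-periodic : ∀ s → U (s + n) ≡ U s
  U-periodic s = cong (toℕ ∘ lookup u) (Finₚ.toℕ-injective (begin
    toℕ ((s + n) mod n)   ≡⟨ Finₚ.toℕ-fromℕ< (m%n<n (s + n) n) ⟩
    (s + n) % n           ≡⟨ [m+n]%n≡m%n s n ⟩
    s % n                 ≡⟨ Finₚ.toℕ-fromℕ< (m%n<n s n) ⟨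
    toℕ (s mod n)         ∎))
  module C = CyclicWindows r U (λ s → s≤s⁻¹ (Finₚ.toℕ<n _)) U-periodic p U[p]≡M U≢M

𝟙 : {P : Set} → Dec P → ℚ
𝟙 (yes _) = 1ℚ
𝟙 (no _)  = 0ℚ

𝟙-yes : {P : Set} (d : Dec P) → P → 𝟙 d ≡ 1ℚ
𝟙-yes (yes _) p = refl
𝟙-yes (no ¬p) p = ⊥-elim (¬p p)

𝟙-no : {P : Set} (d : Dec P) → ¬ P → 𝟙 d ≡ 0ℚ
𝟙-no (yes p) ¬p = ⊥-elim (¬p p)
𝟙-no (no _)  ¬p = refl

𝟙-⇔ : {P Q : Set} (d : Dec P) (e : Dec Q) → (P → Q) → (Q → P) → 𝟙 d ≡ 𝟙 e
𝟙-⇔ (yes p) e to from = sym (𝟙-yes e (to p))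
𝟙-⇔ (no ¬p) e to from = sym (𝟙-no e (¬p ∘ from))

infix 4 _≟ᵛ_
_≟ᵛ_ : ∀ {n m} (u v : Vec (Fin n) m) → Dec (u ≡ v)
_≟ᵛ_ = vec-dec _≟ᶠ_

𝟙-∷ : ∀ {n m} (x y : Fin n) (u v : Vec (Fin n) m) → 𝟙 (x ∷ u ≟ᵛ y ∷ v) ≡ 𝟙 (x ≟ᶠ y) *ℚ 𝟙 (u ≟ᵛ v)
𝟙-∷ x y u v = cases (x ≟ᶠ y) (u ≟ᵛ v)
  where
  open ≡-Reasoning
  cases : Dec (x ≡ y) → Dec (u ≡ v) → 𝟙 (x ∷ u ≟ᵛ y ∷ v) ≡ 𝟙 (x ≟ᶠ y) *ℚ 𝟙 (u ≟ᵛ v)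
  cases (yes x≡y) (yes u≡v) = begin
    𝟙 (x ∷ u ≟ᵛ y ∷ v)            ≡⟨ 𝟙-yes (x ∷ u ≟ᵛ y ∷ v) (cong₂ _∷_ x≡y u≡v) ⟩
    1ℚ *ℚ 1ℚ                       ≡⟨ cong₂ _*ℚ_ (𝟙-yes (x ≟ᶠ y) x≡y) (𝟙-yes (u ≟ᵛ v) u≡v) ⟨
    𝟙 (x ≟ᶠ y) *ℚ 𝟙 (u ≟ᵛ v)      ∎
  cases _ (no u≢v) = begin
    𝟙 (x ∷ u ≟ᵛ y ∷ v)            ≡⟨ 𝟙-no (x ∷ u ≟ᵛ y ∷ v) (u≢v ∘ cong Vec.tail) ⟩
    0ℚ                            ≡⟨ ℚₚ.*-zeroʳ (𝟙 (x ≟ᶠ y)) ⟨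
    𝟙 (x ≟ᶠ y) *ℚ 0ℚ               ≡⟨ cong (𝟙 (x ≟ᶠ y) *ℚ_) (𝟙-no (u ≟ᵛ v) u≢v) ⟨
    𝟙 (x ≟ᶠ y) *ℚ 𝟙 (u ≟ᵛ v)      ∎
  cases (no x≢y) _ = begin
    𝟙 (x ∷ u ≟ᵛ y ∷ v)            ≡⟨ 𝟙-no (x ∷ u ≟ᵛ y ∷ v) (x≢y ∘ cong Vec.head) ⟩
    0ℚ                            ≡⟨ ℚₚ.*-zeroˡ (𝟙 (u ≟ᵛ v)) ⟨
    0ℚ *ℚ 𝟙 (u ≟ᵛ v)               ≡⟨ cong (_*ℚ 𝟙 (u ≟ᵛ v)) (𝟙-no (x ≟ᶠ y) x≢y) ⟨
    𝟙 (x ≟ᶠ y) *ℚ 𝟙 (u ≟ᵛ v)      ∎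

∑ᴸ : {A : Set} → List A → (A → ℚ) → ℚ
∑ᴸ []       f = 0ℚ
∑ᴸ (x ∷ xs) f = f x +ℚ ∑ᴸ xs f

∑ᴸ-cong : {A : Set} (xs : List A) {f g : A → ℚ} → (∀ x → f x ≡ g x) → ∑ᴸ xs f ≡ ∑ᴸ xs g
∑ᴸ-cong []       f≡g = refl
∑ᴸ-cong (x ∷ xs) f≡g = cong₂ _+ℚ_ (f≡g x) (∑ᴸ-cong xs f≡g)

∑ᴸ-++ : {A : Set} (xs ys : List A) (f : A → ℚ) → ∑ᴸ (xs ++ ys) f ≡ ∑ᴸ xs f +ℚ ∑ᴸ ys f
∑ᴸ-++ []       ys f = sym (ℚₚ.+-identityˡ _)
∑ᴸ-++ (x ∷ xs) ys f = trans (cong (λ s → f x +ℚ s) (∑ᴸ-++ xs ys f)) (sym (ℚₚ.+-assoc (f x) _ _))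

∑ᴸ-map : {A B : Set} (g : A → B) (xs : List A) (f : B → ℚ) → ∑ᴸ (map g xs) f ≡ ∑ᴸ xs (f ∘ g)
∑ᴸ-map g []       f = refl
∑ᴸ-map g (x ∷ xs) f = cong (λ s → f (g x) +ℚ s) (∑ᴸ-map g xs f)

∑ᴸ-concatMap : {A B : Set} (g : A → List B) (xs : List A) (f : B → ℚ) →
               ∑ᴸ (concatMap g xs) f ≡ ∑ᴸ xs (λ x → ∑ᴸ (g x) f)
∑ᴸ-concatMap g []       f = refl
∑ᴸ-concatMap g (x ∷ xs) f =
  trans (∑ᴸ-++ (g x) (concatMap g xs) f) (cong (λ s → ∑ᴸ (g x) f +ℚ s) (∑ᴸ-concatMap g xs f))

∑ᴸ-filter : {A : Set} {P : A → Set} (P? : Decidable P) (xs : List A) (f : A → ℚ) →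
            ∑ᴸ (filter P? xs) f ≡ ∑ᴸ xs (λ x → if does (P? x) then f x else 0ℚ)
∑ᴸ-filter P? []       f = refl
∑ᴸ-filter P? (x ∷ xs) f with does (P? x)
... | true  = cong (λ s → f x +ℚ s) (∑ᴸ-filter P? xs f)
... | false = trans (∑ᴸ-filter P? xs f) (sym (ℚₚ.+-identityˡ _))

∑ᴸ-0ℚ : {A : Set} (xs : List A) → ∑ᴸ xs (λ _ → 0ℚ) ≡ 0ℚ
∑ᴸ-0ℚ []       = refl
∑ᴸ-0ℚ (x ∷ xs) = trans (ℚₚ.+-identityˡ _) (∑ᴸ-0ℚ xs)

∑ᴸ-applyUpTo : (g : ℕ → ℕ) (L : ℕ) (f : ℕ → ℚ) → ∑ᴸ (applyUpTo g L) f ≡ ∑< L (f ∘ g)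
∑ᴸ-applyUpTo g zero    f = refl
∑ᴸ-applyUpTo g (suc L) f = cong (λ s → f (g 0) +ℚ s) (∑ᴸ-applyUpTo (g ∘ suc) L f)

∑ᴸ-*ˡ : {A : Set} (xs : List A) (x : ℚ) (f : A → ℚ) → ∑ᴸ xs (λ a → x *ℚ f a) ≡ x *ℚ ∑ᴸ xs f
∑ᴸ-*ˡ []       x f = sym (ℚₚ.*-zeroʳ x)
∑ᴸ-*ˡ (a ∷ xs) x f =
  trans (cong (λ s → x *ℚ f a +ℚ s) (∑ᴸ-*ˡ xs x f)) (sym (ℚₚ.*-distribˡ-+ x (f a) _))

∑ᴸ-∑<-comm : {A : Set} (xs : List A) (L : ℕ) (f : A → ℕ → ℚ) →
             ∑ᴸ xs (λ a → ∑< L (f a)) ≡ ∑< L (λ i → ∑ᴸ xs (λ a → f a i))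
∑ᴸ-∑<-comm []       L f = sym (∑<-ε L)
∑ᴸ-∑<-comm (a ∷ xs) L f =
  trans (cong (λ s → ∑< L (f a) +ℚ s) (∑ᴸ-∑<-comm xs L f)) (sym (∑<-distrib L (f a) _))

∑ᴸ-allFin-select : ∀ n (g : Fin n → ℚ) y → ∑ᴸ (toList (allFin n)) (λ x → g x *ℚ 𝟙 (x ≟ᶠ y)) ≡ g y
∑ᴸ-allFin-select (suc n) g y = begin
  ∑ᴸ (toList (allFin (suc n))) h
    ≡⟨ cong (λ v → ∑ᴸ (toList v) h) (allFin-map n) ⟩
  h Fin.zero +ℚ ∑ᴸ (toList (Vec.map Fin.suc (allFin n))) h
    ≡⟨ cong (λ xs → h Fin.zero +ℚ ∑ᴸ xs h) (toList-map Fin.suc (allFin n)) ⟩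
  h Fin.zero +ℚ ∑ᴸ (map Fin.suc (toList (allFin n))) h
    ≡⟨ cong (λ s → h Fin.zero +ℚ s) (∑ᴸ-map Fin.suc (toList (allFin n)) h) ⟩
  h Fin.zero +ℚ ∑ᴸ (toList (allFin n)) (h ∘ Fin.suc)
    ≡⟨ split y ⟩
  g y ∎
  where
  open ≡-Reasoning
  h : Fin (suc n) → ℚ
  h x = g x *ℚ 𝟙 (x ≟ᶠ y)
  split : ∀ y → g Fin.zero *ℚ 𝟙 (Fin.zero ≟ᶠ y)
                  +ℚ ∑ᴸ (toList (allFin n)) (λ x → g (Fin.suc x) *ℚ 𝟙 (Fin.suc x ≟ᶠ y)) ≡ g y
  split Fin.zero = begin
    g Fin.zero *ℚ 1ℚ +ℚ ∑ᴸ (toList (allFin n)) (λ x → g (Fin.suc x) *ℚ 0ℚ)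
      ≡⟨ cong₂ _+ℚ_ (ℚₚ.*-identityʳ (g Fin.zero)) (∑ᴸ-cong (toList (allFin n)) (λ x → ℚₚ.*-zeroʳ (g (Fin.suc x)))) ⟩
    g Fin.zero +ℚ ∑ᴸ (toList (allFin n)) (λ _ → 0ℚ)
      ≡⟨ cong (λ s → g Fin.zero +ℚ s) (∑ᴸ-0ℚ (toList (allFin n))) ⟩
    g Fin.zero +ℚ 0ℚ
      ≡⟨ ℚₚ.+-identityʳ _ ⟩
    g Fin.zero ∎
  split (Fin.suc y) = begin
    g Fin.zero *ℚ 0ℚ +ℚ ∑ᴸ (toList (allFin n)) (λ x → g (Fin.suc x) *ℚ 𝟙 (Fin.suc x ≟ᶠ Fin.suc y))
      ≡⟨ cong₂ _+ℚ_ (ℚₚ.*-zeroʳ (g Fin.zero)) (∑ᴸ-cong (toList (allFin n)) (λ x → cong (g (Fin.suc x) *ℚ_) (𝟙-suc x))) ⟩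
    0ℚ +ℚ ∑ᴸ (toList (allFin n)) (λ x → g (Fin.suc x) *ℚ 𝟙 (x ≟ᶠ y))
      ≡⟨ ℚₚ.+-identityˡ _ ⟩
    ∑ᴸ (toList (allFin n)) (λ x → g (Fin.suc x) *ℚ 𝟙 (x ≟ᶠ y))
      ≡⟨ ∑ᴸ-allFin-select n (g ∘ Fin.suc) y ⟩
    g (Fin.suc y) ∎
    where
    𝟙-suc : ∀ x → 𝟙 (Fin.suc {n} x ≟ᶠ Fin.suc y) ≡ 𝟙 (x ≟ᶠ y)
    𝟙-suc x = 𝟙-⇔ (Fin.suc x ≟ᶠ Fin.suc y) (x ≟ᶠ y) Finₚ.suc-injective (cong Fin.suc)

coeff-∑ᴸ : ∀ {n} (x : QS n) w → coeff x w ≡ ∑ᴸ x (λ (q , u) → q *ℚ 𝟙 (u ≟ᵛ w))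
coeff-∑ᴸ []            w = refl
coeff-∑ᴸ ((q , u) ∷ x) w with u ≟ᵛ w
... | yes _ = cong₂ _+ℚ_ (sym (ℚₚ.*-identityʳ q)) (coeff-∑ᴸ x w)
... | no  _ = trans (coeff-∑ᴸ x w) (trans (sym (ℚₚ.+-identityˡ _)) (cong (_+ℚ _) (sym (ℚₚ.*-zeroʳ q))))

coeff-· : ∀ {n} (x y : QS n) w →
          coeff (x · y) w ≡ ∑ᴸ x (λ (p , u) → ∑ᴸ y (λ (q , v) → (p *ℚ q) *ℚ 𝟙 (u ∘ₚ v ≟ᵛ w)))
coeff-· x y w = trans (coeff-∑ᴸ (x · y) w) (trans (∑ᴸ-concatMap _ x _) (∑ᴸ-cong x (λ e → ∑ᴸ-map _ y _)))

if-does : {P : Set} (d : Dec P) (q : ℚ) → (if does d then q else 0ℚ) ≡ 𝟙 d *ℚ q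
if-does (yes _) q = sym (ℚₚ.*-identityˡ q)
if-does (no _)  q = sym (ℚₚ.*-zeroˡ q)

∑ᴸ-allVecs-select : ∀ n m (g : Vec (Fin n) m → ℚ) v₀ → ∑ᴸ (allVecs n m) (λ v → g v *ℚ 𝟙 (v ≟ᵛ v₀)) ≡ g v₀
∑ᴸ-allVecs-select n zero    g [] =
  trans (ℚₚ.+-identityʳ _) (trans (cong (g [] *ℚ_) (𝟙-yes (_≟ᵛ_ {n = n} [] []) refl)) (ℚₚ.*-identityʳ (g [])))
∑ᴸ-allVecs-select n (suc m) g (y ∷ v₀) = begin
  ∑ᴸ (allVecs n (suc m)) (λ v → g v *ℚ 𝟙 (v ≟ᵛ y ∷ v₀))
    ≡⟨ ∑ᴸ-concatMap (λ x → map (x ∷_) (allVecs n m)) (toList (allFin n)) _ ⟩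
  ∑ᴸ (toList (allFin n)) (λ x → ∑ᴸ (map (x ∷_) (allVecs n m)) (λ v → g v *ℚ 𝟙 (v ≟ᵛ y ∷ v₀)))
    ≡⟨ ∑ᴸ-cong (toList (allFin n)) (λ x → ∑ᴸ-map (x ∷_) (allVecs n m) _) ⟩
  ∑ᴸ (toList (allFin n)) (λ x → ∑ᴸ (allVecs n m) (λ v → g (x ∷ v) *ℚ 𝟙 (x ∷ v ≟ᵛ y ∷ v₀)))
    ≡⟨ ∑ᴸ-cong (toList (allFin n)) (λ x → ∑ᴸ-cong (allVecs n m) (λ v → split x v)) ⟩
  ∑ᴸ (toList (allFin n)) (λ x → ∑ᴸ (allVecs n m) (λ v → (g (x ∷ v) *ℚ 𝟙 (x ≟ᶠ y)) *ℚ 𝟙 (v ≟ᵛ v₀)))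
    ≡⟨ ∑ᴸ-cong (toList (allFin n)) (λ x → ∑ᴸ-allVecs-select n m (λ v → g (x ∷ v) *ℚ 𝟙 (x ≟ᶠ y)) v₀) ⟩
  ∑ᴸ (toList (allFin n)) (λ x → g (x ∷ v₀) *ℚ 𝟙 (x ≟ᶠ y))
    ≡⟨ ∑ᴸ-allFin-select n (λ x → g (x ∷ v₀)) y ⟩
  g (y ∷ v₀) ∎
  where
  open ≡-Reasoning
  split : ∀ x v → g (x ∷ v) *ℚ 𝟙 (x ∷ v ≟ᵛ y ∷ v₀) ≡ (g (x ∷ v) *ℚ 𝟙 (x ≟ᶠ y)) *ℚ 𝟙 (v ≟ᵛ v₀)
  split x v = trans (cong (g (x ∷ v) *ℚ_) (𝟙-∷ x y v v₀)) (sym (ℚₚ.*-assoc (g (x ∷ v)) _ _))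

∑ᴸ-Sym-select : ∀ n (g : Word n → ℚ) w → ∑ᴸ (Sym n) (λ v → g v *ℚ 𝟙 (v ≟ᵛ w)) ≡ 𝟙 (isPerm? w) *ℚ g w
∑ᴸ-Sym-select n g w = begin
  ∑ᴸ (Sym n) (λ v → g v *ℚ 𝟙 (v ≟ᵛ w))
    ≡⟨ ∑ᴸ-filter isPerm? (allVecs n n) _ ⟩
  ∑ᴸ (allVecs n n) (λ v → if does (isPerm? v) then g v *ℚ 𝟙 (v ≟ᵛ w) else 0ℚ)
    ≡⟨ ∑ᴸ-cong (allVecs n n) (λ v →
         trans (if-does (isPerm? v) _) (sym (ℚₚ.*-assoc (𝟙 (isPerm? v)) (g v) (𝟙 (v ≟ᵛ w))))) ⟩
  ∑ᴸ (allVecs n n) (λ v → (𝟙 (isPerm? v) *ℚ g v) *ℚ 𝟙 (v ≟ᵛ w))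
    ≡⟨ ∑ᴸ-allVecs-select n n (λ v → 𝟙 (isPerm? v) *ℚ g v) w ⟩
  𝟙 (isPerm? w) *ℚ g w ∎
  where open ≡-Reasoning

coeff-onSym : ∀ n (f : Word n → ℚ) w → coeff (map (λ v → (f v , v)) (Sym n)) w ≡ 𝟙 (isPerm? w) *ℚ f w
coeff-onSym n f w = begin
  coeff (map (λ v → (f v , v)) (Sym n)) w          ≡⟨ coeff-∑ᴸ (map (λ v → (f v , v)) (Sym n)) w ⟩
  ∑ᴸ (map (λ v → (f v , v)) (Sym n)) (λ (q , u) → q *ℚ 𝟙 (u ≟ᵛ w))
                                                   ≡⟨ ∑ᴸ-map (λ v → (f v , v)) (Sym n) _ ⟩
  ∑ᴸ (Sym n) (λ v → f v *ℚ 𝟙 (v ≟ᵛ w))              ≡⟨ ∑ᴸ-Sym-select n f w ⟩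
  𝟙 (isPerm? w) *ℚ f w                              ∎
  where open ≡-Reasoning

𝟙-∘ₚˡ : ∀ {n} (σ u w : Word n) → IsPerm σ → 𝟙 (σ ∘ₚ u ≟ᵛ w) ≡ 𝟙 (u ≟ᵛ inv σ ∘ₚ w)
𝟙-∘ₚˡ σ u w σ-inj = 𝟙-⇔ (σ ∘ₚ u ≟ᵛ w) (u ≟ᵛ inv σ ∘ₚ w) (∘ₚ-moveˡ σ u w σ-inj) (∘ₚ-moveˡ⁻ σ u w σ-inj)

𝟙-∘ₚʳ : ∀ {n} (σ u w : Word n) → IsPerm σ → 𝟙 (u ∘ₚ σ ≟ᵛ w) ≡ 𝟙 (u ≟ᵛ w ∘ₚ inv σ)
𝟙-∘ₚʳ σ u w σ-inj = 𝟙-⇔ (u ∘ₚ σ ≟ᵛ w) (u ≟ᵛ w ∘ₚ inv σ) (∘ₚ-moveʳ σ u w σ-inj) (∘ₚ-moveʳ⁻ σ u w σ-inj)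

module UniformCombination {n} (L : ℕ) (c : ℚ) (g : ℕ → Word n) (g-perm : ∀ i → IsPerm (g i)) where

  X : QS n
  X = map (λ i → (c , g i)) (upTo L)

  coeff-X· : ∀ y w → coeff (X · y) w ≡ ∑< L (λ i → c *ℚ coeff y (inv (g i) ∘ₚ w))
  coeff-X· y w = begin
    coeff (X · y) w
      ≡⟨ coeff-· X y w ⟩
    ∑ᴸ X (λ (p , u) → ∑ᴸ y (λ (q , v) → (p *ℚ q) *ℚ 𝟙 (u ∘ₚ v ≟ᵛ w)))
      ≡⟨ ∑ᴸ-map _ (upTo L) _ ⟩
    ∑ᴸ (upTo L) (λ i → ∑ᴸ y (λ (q , v) → (c *ℚ q) *ℚ 𝟙 (g i ∘ₚ v ≟ᵛ w)))
      ≡⟨ ∑ᴸ-applyUpTo (λ i → i) L _ ⟩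
    ∑< L (λ i → ∑ᴸ y (λ (q , v) → (c *ℚ q) *ℚ 𝟙 (g i ∘ₚ v ≟ᵛ w)))
      ≡⟨ ∑<-cong L (λ i _ → ∑ᴸ-cong y (λ (q , v) →
           trans (ℚₚ.*-assoc c q _) (cong (λ z → c *ℚ (q *ℚ z)) (𝟙-∘ₚˡ (g i) v w (g-perm i))))) ⟩
    ∑< L (λ i → ∑ᴸ y (λ (q , v) → c *ℚ (q *ℚ 𝟙 (v ≟ᵛ inv (g i) ∘ₚ w))))
      ≡⟨ ∑<-cong L (λ i _ → trans (∑ᴸ-*ˡ y c _) (cong (c *ℚ_) (sym (coeff-∑ᴸ y (inv (g i) ∘ₚ w))))) ⟩
    ∑< L (λ i → c *ℚ coeff y (inv (g i) ∘ₚ w)) ∎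
    where open ≡-Reasoning

  coeff-·X : ∀ x w → coeff (x · X) w ≡ ∑< L (λ i → c *ℚ coeff x (w ∘ₚ inv (g i)))
  coeff-·X x w = begin
    coeff (x · X) w
      ≡⟨ coeff-· x X w ⟩
    ∑ᴸ x (λ (p , u) → ∑ᴸ X (λ (q , v) → (p *ℚ q) *ℚ 𝟙 (u ∘ₚ v ≟ᵛ w)))
      ≡⟨ ∑ᴸ-cong x (λ (p , u) → trans (∑ᴸ-map _ (upTo L) _) (∑ᴸ-applyUpTo (λ i → i) L _)) ⟩
    ∑ᴸ x (λ (p , u) → ∑< L (λ i → (p *ℚ c) *ℚ 𝟙 (u ∘ₚ g i ≟ᵛ w)))
      ≡⟨ ∑ᴸ-∑<-comm x L _ ⟩
    ∑< L (λ i → ∑ᴸ x (λ (p , u) → (p *ℚ c) *ℚ 𝟙 (u ∘ₚ g i ≟ᵛ w)))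
      ≡⟨ ∑<-cong L (λ i _ → ∑ᴸ-cong x (λ (p , u) →
           trans (cong₂ _*ℚ_ (ℚₚ.*-comm p c) (𝟙-∘ₚʳ (g i) u w (g-perm i))) (ℚₚ.*-assoc c p _))) ⟩
    ∑< L (λ i → ∑ᴸ x (λ (p , u) → c *ℚ (p *ℚ 𝟙 (u ≟ᵛ w ∘ₚ inv (g i)))))
      ≡⟨ ∑<-cong L (λ i _ → trans (∑ᴸ-*ˡ x c _) (cong (c *ℚ_) (sym (coeff-∑ᴸ x (w ∘ₚ inv (g i)))))) ⟩
    ∑< L (λ i → c *ℚ coeff x (w ∘ₚ inv (g i))) ∎
    where open ≡-Reasoning

-- Multiplying by the cut

module CutInvariance (m : ℕ) (F : ℕ → ℚ) where

  n : ℕ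
  n = suc m

  1/n : ℚ
  1/n = 1 ÷ℕ n

  S : QS n
  S = map (λ w → (F (des (inv w)) , w)) (Sym n)

  A : QS n
  A = cut n · S

  ζ-perm : IsPerm (ζ n)
  ζ-perm = IsPerm-ζ m

  ζ^-perm : ∀ i → IsPerm (ζ n ^ₚ i)
  ζ^-perm = IsPerm-ζ^ m

  open UniformCombination n 1/n (ζ n ^ₚ_) ζ^-perm

  coeff-A-perm : ∀ w → IsPerm w → coeff A w ≡ ∑< n (λ i → 1/n *ℚ F (des (inv w ∘ₚ (ζ n ^ₚ i))))
  coeff-A-perm w w-perm = trans (coeff-X· S w) (∑<-cong n (λ i _ → cong (1/n *ℚ_) (begin
    coeff S (shifted i)
      ≡⟨ coeff-onSym n (F ∘ des ∘ inv) (shifted i) ⟩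
    𝟙 (isPerm? (shifted i)) *ℚ F (des (inv (shifted i)))
      ≡⟨ cong₂ (λ a v → a *ℚ F (des v)) (𝟙-yes (isPerm? (shifted i)) (shifted-perm i)) (inv-shifted i) ⟩
    1ℚ *ℚ F (des (inv w ∘ₚ (ζ n ^ₚ i)))
      ≡⟨ ℚₚ.*-identityˡ _ ⟩
    F (des (inv w ∘ₚ (ζ n ^ₚ i))) ∎)))
    where
    open ≡-Reasoning
    shifted : ℕ → Word n
    shifted i = inv (ζ n ^ₚ i) ∘ₚ w
    shifted-perm : ∀ i → IsPerm (shifted i)
    shifted-perm i = IsPerm-∘ₚ (inv (ζ n ^ₚ i)) w (IsPerm-inv (ζ n ^ₚ i) (ζ^-perm i)) w-perm
    inv-shifted : ∀ i → inv (shifted i) ≡ inv w ∘ₚ (ζ n ^ₚ i)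
    inv-shifted i = trans (inv-∘ₚ (inv (ζ n ^ₚ i)) w (IsPerm-inv (ζ n ^ₚ i) (ζ^-perm i)) w-perm)
                          (cong (inv w ∘ₚ_) (inv-involutive (ζ n ^ₚ i) (ζ^-perm i)))

  coeff-A-nonperm : ∀ w → ¬ IsPerm w → coeff A w ≡ 0ℚ
  coeff-A-nonperm w w-nonperm = trans (coeff-X· S w) (trans (∑<-cong n (λ i _ → begin
    1/n *ℚ coeff S (shifted i)
      ≡⟨ cong (1/n *ℚ_) (coeff-onSym n (F ∘ des ∘ inv) (shifted i)) ⟩
    1/n *ℚ (𝟙 (isPerm? (shifted i)) *ℚ F (des (inv (shifted i))))
      ≡⟨ cong (λ a → 1/n *ℚ (a *ℚ F (des (inv (shifted i)))))
              (𝟙-no (isPerm? (shifted i)) (w-nonperm ∘ unshift i)) ⟩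
    1/n *ℚ (0ℚ *ℚ F (des (inv (shifted i))))
      ≡⟨ trans (cong (1/n *ℚ_) (ℚₚ.*-zeroˡ (F (des (inv (shifted i)))))) (ℚₚ.*-zeroʳ 1/n) ⟩
    0ℚ ∎)) (∑<-ε n))
    where
    open ≡-Reasoning
    shifted : ℕ → Word n
    shifted i = inv (ζ n ^ₚ i) ∘ₚ w
    unshift : ∀ i → IsPerm (shifted i) → IsPerm w
    unshift i shifted-perm = subst IsPerm (∘ₚ-moveˡ⁻ (ζ n ^ₚ i) (shifted i) w (ζ^-perm i) refl)
      (IsPerm-∘ₚ (ζ n ^ₚ i) (shifted i) (ζ^-perm i) shifted-perm)

  coeff-A-∘ζ : ∀ w → coeff A (w ∘ₚ ζ n) ≡ coeff A w
  coeff-A-∘ζ w with isPerm? w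
  ... | no w-nonperm =
    trans (coeff-A-nonperm (w ∘ₚ ζ n) (w-nonperm ∘ unrotate)) (sym (coeff-A-nonperm w w-nonperm))
    where
    unrotate : IsPerm (w ∘ₚ ζ n) → IsPerm w
    unrotate rotated-perm = subst IsPerm (sym (∘ₚ-moveʳ (ζ n) w (w ∘ₚ ζ n) ζ-perm refl))
      (IsPerm-∘ₚ (w ∘ₚ ζ n) (inv (ζ n)) rotated-perm (IsPerm-inv (ζ n) ζ-perm))
  ... | yes w-perm = begin
    coeff A (w ∘ₚ ζ n)
      ≡⟨ coeff-A-perm (w ∘ₚ ζ n) (IsPerm-∘ₚ w (ζ n) w-perm ζ-perm) ⟩
    ∑< n (λ i → G (inv (w ∘ₚ ζ n) ∘ₚ (ζ n ^ₚ i)))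
      ≡⟨ ∑<-cong n (λ i _ → cong (λ v → G (v ∘ₚ (ζ n ^ₚ i))) (inv-∘ₚ w (ζ n) w-perm ζ-perm)) ⟩
    ∑< n (λ i → G (u ∘ₚ (ζ n ^ₚ i)))
      ≡⟨ ∑<-des-rotations-ζ∘ₚ m u u-perm (λ d → 1/n *ℚ F d) ⟨
    ∑< n (λ i → G ((ζ n ∘ₚ u) ∘ₚ (ζ n ^ₚ i)))
      ≡⟨ ∑<-cong n (λ i _ → cong (λ v → G (v ∘ₚ (ζ n ^ₚ i))) (∘ₚ-moveˡ⁻ (ζ n) u (inv w) ζ-perm refl)) ⟩
    ∑< n (λ i → G (inv w ∘ₚ (ζ n ^ₚ i)))
      ≡⟨ coeff-A-perm w w-perm ⟨
    coeff A w ∎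
    where
    open ≡-Reasoning
    G : Word n → ℚ
    G v = 1/n *ℚ F (des v)
    u : Word n
    u = inv (ζ n) ∘ₚ inv w
    u-perm : IsPerm u
    u-perm = IsPerm-∘ₚ (inv (ζ n)) (inv w) (IsPerm-inv (ζ n) ζ-perm) (IsPerm-inv w w-perm)

  coeff-A-∘ζ^ : ∀ a w → coeff A (w ∘ₚ (ζ n ^ₚ a)) ≡ coeff A w
  coeff-A-∘ζ^ zero    w = cong (coeff A) (∘ₚ-identityʳ w)
  coeff-A-∘ζ^ (suc a) w = begin
    coeff A (w ∘ₚ (ζ n ∘ₚ (ζ n ^ₚ a)))   ≡⟨ cong (coeff A) (∘ₚ-assoc w (ζ n) (ζ n ^ₚ a)) ⟨
    coeff A ((w ∘ₚ ζ n) ∘ₚ (ζ n ^ₚ a))   ≡⟨ coeff-A-∘ζ^ a (w ∘ₚ ζ n) ⟩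
    coeff A (w ∘ₚ ζ n)                   ≡⟨ coeff-A-∘ζ w ⟩
    coeff A w                            ∎
    where open ≡-Reasoning

  coeff-A-∘inv-ζ^ : ∀ a w → coeff A (w ∘ₚ inv (ζ n ^ₚ a)) ≡ coeff A w
  coeff-A-∘inv-ζ^ a w = begin
    coeff A (w ∘ₚ inv (ζ n ^ₚ a))                   ≡⟨ coeff-A-∘ζ^ a (w ∘ₚ inv (ζ n ^ₚ a)) ⟨
    coeff A ((w ∘ₚ inv (ζ n ^ₚ a)) ∘ₚ (ζ n ^ₚ a))   ≡⟨ cong (coeff A) (∘ₚ-moveʳ⁻ (ζ n ^ₚ a) _ w (ζ^-perm a) refl) ⟩
    coeff A w                                        ∎
    where open ≡-Reasoning

  cut·S·cut≈cut·S : (A · cut n) ≈ A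
  cut·S·cut≈cut·S w = begin
    coeff (A · cut n) w                                ≡⟨ coeff-·X A w ⟩
    ∑< n (λ i → 1/n *ℚ coeff A (w ∘ₚ inv (ζ n ^ₚ i)))  ≡⟨ ∑<-cong n (λ i _ → cong (1/n *ℚ_) (coeff-A-∘inv-ζ^ i w)) ⟩
    ∑< n (λ _ → 1/n *ℚ coeff A w)                      ≡⟨ ∑<-mean-const m (coeff A w) ⟩
    coeff A w                                          ∎
    where open ≡-Reasoning

-- riffle n k is S for the weight F d = binom(n+k−d−1, n)/kⁿ.
mainTheorem3 : (n k : ℕ) → 1 ≤ n → 1 ≤ k →
    ((cut n · riffle n k) · cut n) ≈ (cut n · riffle n k)
mainTheorem3 (suc m) k _ _ = CutInvariance.cut·S·cut≈cut·S m riffleWeight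
  where
  riffleWeight : ℕ → ℚ
  riffleWeight d = ((suc m + k ∸ d ∸ 1) C suc m) ÷ℕ (k ^ suc m)
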